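{- For every Boolean algebra $\mathcal{B}$ and all $z=(z_1,z_2,z_3)$, $w=(w_1,w_2,w_3)$ in the domain of $\mathcal{T}_\mathcal{B}$, the lattice order of $\mathcal{T}_\mathcal{B}$ satisfies: $z\le w$ if and only if $z_1\le w_1$, $z_2\ge w_2$, $z_2\sqcap z_3\ge w_2\sqcap w_3$, and $z_3\le(z_1\sqcap w_3)\sqcup z_2$.
   Context: For a Boolean algebra $\mathcal{B}=\langle\mathbf{B},\sqcap,\sqcup,\Rightarrow,\sim,0,1\rangle$ (with order $\le$), the twist structure $\mathcal{T}_\mathcal{B}$ has domain $B^{\mathcal{B}}_{LET_K}=\{z\in\mathbf{B}^3: z_3\le z_1\sqcup z_2,\ z_1\sqcap z_2\sqcap z_3=0\}$ and, among others, the operations $z\tilde\land w=(z_1\sqcap w_1,\ z_2\sqcup w_2,\ (z_1\sqcap z_3\sqcap w_1\sqcap w_3)\sqcup(z_2\sqcap z_3)\sqcup(w_2\sqcap w_3))$ and $z\tilde\lor w=(z_1\sqcup w_1,\ z_2\sqcap w_2,\ (z_2\sqcap z_3\sqcap w_2\sqcap w_3)\sqcup(z_1\sqcap z_3)\sqcup(w_1\sqcap w_3))$; $\langle B^{\mathcal{B}}_{LET_K},\tilde\land,\tilde\lor\rangle$ is a lattice, and its order is defined by $z\le w$ iff $z=z\tilde\land w$. -}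

module Defs where

open import Level using (Level)
open import Data.Product using (_×_; _,_; proj₁; proj₂)
open import Algebra.Lattice.Bundles using (BooleanAlgebra)

module Twist {c ℓ : Level} (B : BooleanAlgebra c ℓ) where
  open BooleanAlgebra B

  _≤B_ : Carrier → Carrier → Set ℓ
  x ≤B y = x ≈ (x ∧ y)

  B³ : Set c
  B³ = Carrier × Carrier × Carrier

  π₁ π₂ π₃ : B³ → Carrier
  π₁ (a , _ , _) = a
  π₂ (_ , b , _) = b
  π₃ (_ , _ , d) = d

  InDomain : B³ → Set ℓ
  InDomain z = (π₃ z ≤B (π₁ z ∨ π₂ z)) × ((π₁ z ∧ π₂ z ∧ π₃ z) ≈ ⊥)

  _∧̃_ : B³ → B³ → B³
  z ∧̃ w = ( π₁ z ∧ π₁ w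
          , π₂ z ∨ π₂ w
          , ((π₁ z ∧ π₃ z ∧ π₁ w ∧ π₃ w) ∨ (π₂ z ∧ π₃ z)) ∨ (π₂ w ∧ π₃ w) )

  _∨̃_ : B³ → B³ → B³
  z ∨̃ w = ( π₁ z ∨ π₁ w
          , π₂ z ∧ π₂ w
          , ((π₂ z ∧ π₃ z ∧ π₂ w ∧ π₃ w) ∨ (π₁ z ∧ π₃ z)) ∨ (π₁ w ∧ π₃ w) )

  _≈³_ : B³ → B³ → Set ℓ
  z ≈³ w = (π₁ z ≈ π₁ w) × (π₂ z ≈ π₂ w) × (π₃ z ≈ π₃ w)

  _≤̃_ : B³ → B³ → Set ℓ
  z ≤̃ w = z ≈³ (z ∧̃ w)

-- Neither the complement nor the domain conditions of the twist structure play a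
-- role: the characterisation holds for arbitrary triples over any distributive
-- lattice. The first two components of z ∧̃ w compare directly, and given
-- z₁ ≤ w₁ and w₂ ≤ z₂ the third component z₃ is fixed by z ∧̃ w exactly when it
-- lies below (z₁ ⊓ w₃) ⊔ z₂ and above w₂ ⊓ w₃, the latter bound being
-- equivalent to w₂ ⊓ w₃ ≤ z₂ ⊓ z₃ since w₂ ≤ z₂.
module Submission where

open import Defs
open import Level using (Level)
open import Data.Product using (_×_; _,_)
open import Function.Bundles using (_⇔_; mk⇔; Equivalence)
open import Algebra.Lattice.Bundles using (BooleanAlgebra; DistributiveLattice)
open import Algebra.Lattice.Properties.Lattice using (∨-∧-orderTheoreticLattice)
import Relation.Binary.Lattice as Order
import Relation.Binary.Lattice.Properties.JoinSemilattice as JoinSemilatticeProperties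
import Relation.Binary.Lattice.Properties.MeetSemilattice as MeetSemilatticeProperties
import Relation.Binary.Reasoning.PartialOrder as ≤-Reasoning

module TwistOrder {c ℓ : Level} (L : DistributiveLattice c ℓ) where
  open DistributiveLattice L

  -- Its order x ≤ y is x ≈ x ∧ y, definitionally the order _≤B_ of the twist structure.
  private
    ordered : Order.Lattice c ℓ ℓ
    ordered = ∨-∧-orderTheoreticLattice lattice

  open Order.Lattice ordered
    using (_≤_; poset; joinSemilattice; meetSemilattice; antisym
          ; x∧y≤x; x∧y≤y; ∧-greatest; x≤x∨y; y≤x∨y; ∨-least)
    renaming (refl to ≤-refl; trans to ≤-trans; reflexive to ≤-reflexive)
  open JoinSemilatticeProperties joinSemilattice using (∨-monotonic; x≤y⇒x∨y≈y)
  open MeetSemilatticeProperties meetSemilattice using (∧-monotonic)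
  open ≤-Reasoning poset

  ≤⇒≈∨ : ∀ {x y} → x ≤ y → y ≈ y ∨ x
  ≤⇒≈∨ {x} {y} x≤y = sym (trans (∨-comm y x) (x≤y⇒x∨y≈y x≤y))

  ≈∨⇒≤ : ∀ {x y} → y ≈ y ∨ x → x ≤ y
  ≈∨⇒≤ {x} {y} y≈y∨x = begin
    x      ≤⟨ y≤x∨y y x ⟩
    y ∨ x  ≈⟨ sym y≈y∨x ⟩
    y      ∎

  twist-third⇔ : ∀ {z₁ z₂ z₃ w₁ w₂ w₃} → z₁ ≤ w₁ → w₂ ≤ z₂ →
    (z₃ ≈ ((z₁ ∧ z₃ ∧ w₁ ∧ w₃) ∨ (z₂ ∧ z₃)) ∨ (w₂ ∧ w₃))
      ⇔ ((w₂ ∧ w₃ ≤ z₂ ∧ z₃) × (z₃ ≤ (z₁ ∧ w₃) ∨ z₂))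
  twist-third⇔ {z₁} {z₂} {z₃} {w₁} {w₂} {w₃} z₁≤w₁ w₂≤z₂ = mk⇔ bounds fixed
    where
    t : Carrier
    t = ((z₁ ∧ z₃ ∧ w₁ ∧ w₃) ∨ (z₂ ∧ z₃)) ∨ (w₂ ∧ w₃)

    w₂∧w₃≤z₂ : w₂ ∧ w₃ ≤ z₂
    w₂∧w₃≤z₂ = ≤-trans (x∧y≤x w₂ w₃) w₂≤z₂

    bounds : z₃ ≈ t → (w₂ ∧ w₃ ≤ z₂ ∧ z₃) × (z₃ ≤ (z₁ ∧ w₃) ∨ z₂)
    bounds z₃≈t = ∧-greatest w₂∧w₃≤z₂ w₂∧w₃≤z₃ , z₃≤bound
      where
      w₂∧w₃≤z₃ : w₂ ∧ w₃ ≤ z₃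
      w₂∧w₃≤z₃ = begin
        w₂ ∧ w₃  ≤⟨ y≤x∨y _ _ ⟩
        t        ≈⟨ sym z₃≈t ⟩
        z₃       ∎

      z₁∧z₃∧w₁∧w₃≤z₁∧w₃ : z₁ ∧ z₃ ∧ w₁ ∧ w₃ ≤ z₁ ∧ w₃
      z₁∧z₃∧w₁∧w₃≤z₁∧w₃ = ∧-monotonic ≤-refl (≤-trans (x∧y≤y z₃ _) (x∧y≤y w₁ w₃))

      z₃≤bound : z₃ ≤ (z₁ ∧ w₃) ∨ z₂
      z₃≤bound = begin
        z₃  ≈⟨ z₃≈t ⟩
        t   ≤⟨ ∨-least (∨-monotonic z₁∧z₃∧w₁∧w₃≤z₁∧w₃ (x∧y≤x z₂ z₃))
                       (≤-trans w₂∧w₃≤z₂ (y≤x∨y _ _)) ⟩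
        (z₁ ∧ w₃) ∨ z₂ ∎

    fixed : (w₂ ∧ w₃ ≤ z₂ ∧ z₃) × (z₃ ≤ (z₁ ∧ w₃) ∨ z₂) → z₃ ≈ t
    fixed (w₂∧w₃≤z₂∧z₃ , z₃≤bound) = antisym z₃≤t t≤z₃
      where
      t≤z₃ : t ≤ z₃
      t≤z₃ = ∨-least (∨-least (≤-trans (x∧y≤y z₁ _) (x∧y≤x z₃ _)) (x∧y≤y z₂ z₃))
                     (≤-trans w₂∧w₃≤z₂∧z₃ (x∧y≤y z₂ z₃))

      z₃∧[z₁∧w₃]≤z₁∧z₃∧w₁∧w₃ : z₃ ∧ (z₁ ∧ w₃) ≤ z₁ ∧ z₃ ∧ w₁ ∧ w₃
      z₃∧[z₁∧w₃]≤z₁∧z₃∧w₁∧w₃ =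
        ∧-greatest z₃∧[z₁∧w₃]≤z₁
          (∧-greatest (x∧y≤x z₃ _)
            (∧-greatest (≤-trans z₃∧[z₁∧w₃]≤z₁ z₁≤w₁)
                        (≤-trans (x∧y≤y z₃ _) (x∧y≤y z₁ w₃))))
        where
        z₃∧[z₁∧w₃]≤z₁ : z₃ ∧ (z₁ ∧ w₃) ≤ z₁
        z₃∧[z₁∧w₃]≤z₁ = ≤-trans (x∧y≤y z₃ _) (x∧y≤x z₁ w₃)

      z₃≤t : z₃ ≤ t
      z₃≤t = begin
        z₃                                ≤⟨ ∧-greatest ≤-refl z₃≤bound ⟩
        z₃ ∧ ((z₁ ∧ w₃) ∨ z₂)             ≈⟨ ∧-distribˡ-∨ z₃ (z₁ ∧ w₃) z₂ ⟩
        (z₃ ∧ (z₁ ∧ w₃)) ∨ (z₃ ∧ z₂)      ≤⟨ ∨-monotonic z₃∧[z₁∧w₃]≤z₁∧z₃∧w₁∧w₃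
                                                         (≤-reflexive (∧-comm z₃ z₂)) ⟩
        (z₁ ∧ z₃ ∧ w₁ ∧ w₃) ∨ (z₂ ∧ z₃)   ≤⟨ x≤x∨y _ _ ⟩
        t                                 ∎

proposition4p6 : {c ℓ : Level} (B : BooleanAlgebra c ℓ) →
    let open BooleanAlgebra B
        open Twist B
    in (z w : B³) → InDomain z → InDomain w →
       (z ≤̃ w) ⇔ ((π₁ z ≤B π₁ w) × (π₂ w ≤B π₂ z)
                  × ((π₂ w ∧ π₃ w) ≤B (π₂ z ∧ π₃ z))
                  × (π₃ z ≤B ((π₁ z ∧ π₃ w) ∨ π₂ z)))
proposition4p6 B z w _ _ = mk⇔
  (λ (z₁≤w₁ , z₂≈z₂∨w₂ , z₃≈t) →
     let w₂≤z₂ = ≈∨⇒≤ z₂≈z₂∨w₂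
     in z₁≤w₁ , w₂≤z₂ , Equivalence.to (twist-third⇔ z₁≤w₁ w₂≤z₂) z₃≈t)
  (λ (z₁≤w₁ , w₂≤z₂ , bounds) →
     z₁≤w₁ , ≤⇒≈∨ w₂≤z₂ , Equivalence.from (twist-third⇔ z₁≤w₁ w₂≤z₂) bounds)
  where open TwistOrder (BooleanAlgebra.distributiveLattice B)
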